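{- Let $P$ be a finite almost polyhedral ranked poset of rank $2$. Suppose that $\bar A_1\ge2$. If the average value $\frac1{p_1}\sum_{e\in P_1}\mathrm{Ric}(e)$ is positive, then $\chi_{gr}(P)>0$.
   Context: For a poset $P$, write $a \prec b$ if $b$ covers $a$. A rank function for $P$ is $\rho:P\to\{0,\dots,r\}$ with $\rho(a)=0$ for minimal $a$ and $\rho(b)=\rho(a)+1$ whenever $a\prec b$; $P$ is ranked if such $\rho$ exists, and its rank is the smallest such $r$. $P_i=\{x\in P\mid\rho(x)=i\}$, $p_i=|P_i|$, and $\chi_{gr}(P)=\sum_i(-1)^ip_i$. $P$ is covering-finite if each element covers finitely many elements and is covered by finitely many elements. For $x\in P_i$: $A_i(x)=|\{y\in P_{i+1}\mid x\prec y\}|$, $B_i(x)=|\{z\in P_{i-1}\mid z\prec x\}|$, and $N_i(x)=\bigl|\{w\in P_i\mid x\prec v,\ w\prec v \text{ for some } v\in P_{i+1}\}\ \triangle\ \{w\in P_i\mid u\prec x,\ u\prec w\text{ for some }u\in P_{i-1}\}\bigr|$ ($\triangle$ = symmetric difference). For $e\in P_1$, $\mathrm{Ric}(e)=A_1(e)+B_1(e)-N_1(e)$, and $\bar A_1=\frac1{p_1}\sum_{e\in P_1}A_1(e)$. A ranked poset of rank $2$ is almost polyhedral if it is covering-finite and for all $w\in P_0$, distinct $a,b\in P_1$, $\tau\in P_2$: (1) $B_1(a)=2$; (2) at most one $v\in P_0$ has $v\prec a$ and $v\prec b$; (3) at most one $\sigma\in P_2$ has $a\prec\sigma$ and $b\prec\sigma$;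 (4) if $w<\tau$ then $[w,\tau]$ has exactly four elements. -}

module Defs where

open import Data.Nat using (ℕ; zero; suc; _≤_; _≡ᵇ_)
open import Data.Integer using (ℤ; +_; _-_) renaming (_+_ to _+ℤ_)
open import Data.Bool using (Bool; true; false; T; _∧_; not; _xor_; if_then_else_)
open import Data.Fin using (Fin; _≟_)
open import Data.List using (List; map; foldr)
open import Data.Nat.ListAction using (sum)
open import Data.Bool.ListAction using (any)
open import Data.List.Base using (allFin)
open import Data.Empty using (⊥)
open import Relation.Nullary using (¬_)
open import Relation.Nullary.Decidable using (⌊_⌋)
open import Relation.Binary.PropositionalEquality using (_≡_)
open import Relation.Binary.Structures using (IsPartialOrder)

record FinPoset : Set where
  field
    n    : ℕ
    le   : Fin n → Fin n → Bool
    isPO : IsPartialOrder _≡_ (λ x y → T (le x y))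

count : {n : ℕ} → (Fin n → Bool) → ℕ
count {n} f = sum (map (λ x → if f x then 1 else 0) (allFin n))

sumℤ : {n : ℕ} → (Fin n → Bool) → (Fin n → ℤ) → ℤ
sumℤ {n} p f = foldr (λ x acc → if p x then f x +ℤ acc else acc) (+ 0) (allFin n)

anyFin : {n : ℕ} → (Fin n → Bool) → Bool
anyFin {n} f = any f (allFin n)

module _ (P : FinPoset) where
  open FinPoset P

  lt : Fin n → Fin n → Bool
  lt x y = le x y ∧ not ⌊ x ≟ y ⌋

  cov : Fin n → Fin n → Bool
  cov a b = lt a b ∧ not (anyFin (λ c → lt a c ∧ lt c b))

  Minimal : Fin n → Set
  Minimal x = ∀ y → ¬ T (lt y x)

  record IsRankFunction (ρ : Fin n → ℕ) (r : ℕ) : Set where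
    field
      bounded : ∀ x → ρ x ≤ r
      minZero : ∀ x → Minimal x → ρ x ≡ 0
      covSuc  : ∀ a b → T (cov a b) → ρ b ≡ suc (ρ a)

  -- P is ranked of rank exactly 2 (smallest r admitting a rank function is 2)
  -- (no rank function into {0,1}; this also excludes {0})
  record RankTwo (ρ : Fin n → ℕ) : Set where
    field
      isRank  : IsRankFunction ρ 2
      notRank1 : ∀ ρ' → ¬ IsRankFunction ρ' 1

  module _ (ρ : Fin n → ℕ) where

    inRank : ℕ → Fin n → Bool
    inRank i x = ρ x ≡ᵇ i

    p : ℕ → ℕ
    p i = count (inRank i)

    χgr : ℤ
    χgr = (+ p 0 - + p 1) +ℤ + p 2

    A₁ : Fin n → ℕ
    A₁ x = count (λ y → inRank 2 y ∧ cov x y)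

    B₁ : Fin n → ℕ
    B₁ x = count (λ z → inRank 0 z ∧ cov z x)

    N₁ : Fin n → ℕ
    N₁ x = count (λ w → inRank 1 w ∧
             (anyFin (λ v → inRank 2 v ∧ cov x v ∧ cov w v)
              xor anyFin (λ u → inRank 0 u ∧ cov u x ∧ cov u w)))

    Ric : Fin n → ℤ
    Ric e = (+ A₁ e +ℤ + B₁ e) - + N₁ e

    sumA₁ : ℕ
    sumA₁ = sum (map (λ e → if inRank 1 e then A₁ e else 0) (allFin n))

    sumRic : ℤ
    sumRic = sumℤ (inRank 1) Ric

    -- almost polyhedral (covering-finiteness is automatic: P is finite)
    record AlmostPolyhedral : Set where
      field
        cond1 : ∀ a → ρ a ≡ 1 → B₁ a ≡ 2
        cond2 : ∀ a b → ρ a ≡ 1 → ρ b ≡ 1 → ¬ a ≡ b →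
                ∀ v v' → ρ v ≡ 0 → ρ v' ≡ 0 →
                T (cov v a) → T (cov v b) → T (cov v' a) → T (cov v' b) → v ≡ v'
        cond3 : ∀ a b → ρ a ≡ 1 → ρ b ≡ 1 → ¬ a ≡ b →
                ∀ σ σ' → ρ σ ≡ 2 → ρ σ' ≡ 2 →
                T (cov a σ) → T (cov b σ) → T (cov a σ') → T (cov b σ') → σ ≡ σ'
        cond4 : ∀ w τ → ρ w ≡ 0 → ρ τ ≡ 2 → T (lt w τ) →
                count (λ x → le w x ∧ le x τ) ≡ 4

Fin' : FinPoset → Set
Fin' P = Fin (FinPoset.n P)

-- Write L e and U e for the edges sharing a vertex, resp. a face, with the edge e, so that
-- N₁ e = |L e △ U e| = |L e| + |U e| − 2 |L e ∩ U e|. By conditions (1)–(3), e shares two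
-- vertices and A₁ e faces with itself but at most one vertex and at most one face with any
-- other edge; by the diamond condition (4), an edge w ≠ e sharing a vertex u and a face σ
-- with e is the element other than e strictly between u and σ, so at most 2 A₁ e edges
-- w ≠ e lie in L e ∩ U e. Together these give
--   Σ_w #(common vertices of e, w) + Σ_w #(common faces of e, w) ≤ N₁ e + 5 A₁ e + 2.
-- Summed over e, the left side double counts to Σ_v deg v² + Σ_σ deg σ² (deg = number of
-- incident edges); as Σ_v deg v = 2 p₁ and Σ_σ deg σ = Σ A₁, the estimate d² ≥ 8d − 16
-- yields 14 p₁ + 3 Σ A₁ ≤ Σ N₁ + 16 (p₀ + p₂), that is Σ Ric + 2 (Σ A₁ − 2 p₁) ≤ 16 χ.
module Submission where

open import Defs
open import Data.Bool using (Bool; true; false; T; _∧_; not; _xor_; if_then_else_)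
open import Data.Bool.Properties using (T-∧; ∧-zeroʳ; ∧-identityʳ; ∧-assoc; ∧-idem)
open import Data.Empty using (⊥-elim)
open import Data.Fin using (Fin; zero; suc; _≟_; punchIn)
open import Data.Fin.Properties using (punchInᵢ≢i)
open import Data.List using (map; foldr)
open import Data.List.Base using (allFin; tabulate)
open import Data.List.Properties using (map-tabulate)
open import Data.List.Membership.Propositional using (lose)
open import Data.List.Membership.Propositional.Properties using (∈-allFin)
open import Data.List.Relation.Unary.Any using (satisfied)
open import Data.List.Relation.Unary.Any.Properties using (any⁺; any⁻)
import Data.Nat.ListAction as List
open import Data.Nat using (ℕ; zero; suc; _+_; _*_; _≤_; _<_; z≤n; s≤s)
open import Data.Nat.Properties hiding (_≟_)
open import Data.Nat.Tactic.RingSolver using (solve-∀)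
open import Data.Product using (∃; ∃₂; _×_; _,_; proj₁; proj₂)
open import Data.Unit using (tt)
open import Function using (_∘_; id)
open import Function.Bundles using (Equivalence)
open import Relation.Binary.PropositionalEquality
open import Relation.Nullary using (¬_)
open import Relation.Nullary.Decidable using (⌊_⌋; yes; no; T?; toWitnessFalse; fromWitnessFalse; decidable-stable)
import Algebra.Properties.Semiring.Sum as SemiringSum
open SemiringSum +-*-semiring
  using (sum-syntax; sum-cong-≗; sum-replicate-zero; ∑-comm; ∑-distrib-+; *-distribˡ-sum; *-distribʳ-sum; sum-remove)
open Equivalence using (to; from)
open import Data.Integer as ℤ using (ℤ; +_; -_; +<+) renaming (_+_ to _+ℤ_; _-_ to _-ℤ_; _<_ to _<ℤ_)
import Data.Integer.Properties as ℤ
open import Data.Integer.Tactic.RingSolver as ℤ-Solver using ()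
open import Relation.Binary.Structures using (IsPartialOrder)

-- Counting over Fin n

𝟙 : Bool → ℕ
𝟙 b = if b then 1 else 0

module _ {n : ℕ} where

  # : (Fin n → Bool) → ℕ
  # c = ∑[ x < n ] 𝟙 (c x)

  ∑∈ : (Fin n → Bool) → (Fin n → ℕ) → ℕ
  ∑∈ c f = ∑[ x < n ] (if c x then f x else 0)

  syntax ∑∈ c (λ x → e) = ∑[ x ∈ c ] e

  _─_ : (Fin n → Bool) → Fin n → Fin n → Bool
  (c ─ a) x = c x ∧ not ⌊ x ≟ a ⌋

sum-allFin : ∀ n (h : Fin n → ℕ) → List.sum (map h (allFin n)) ≡ ∑[ x < n ] h x
sum-allFin n h = trans (cong List.sum (map-tabulate id h)) (sum-tabulate n h)
  where
  sum-tabulate : ∀ n (f : Fin n → ℕ) → List.sum (tabulate f) ≡ ∑[ x < n ] f x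
  sum-tabulate zero    f = refl
  sum-tabulate (suc n) f = cong (_+_ (f zero)) (sum-tabulate n (f ∘ suc))

count≡# : ∀ {n} (c : Fin n → Bool) → count c ≡ # c
count≡# {n} c = sum-allFin n (𝟙 ∘ c)

∑-mono-≤ : ∀ {n} {f g : Fin n → ℕ} → (∀ i → f i ≤ g i) → ∑[ i < n ] f i ≤ ∑[ i < n ] g i
∑-mono-≤ {zero}  _   = z≤n
∑-mono-≤ {suc n} f≤g = +-mono-≤ (f≤g zero) (∑-mono-≤ (f≤g ∘ suc))

∑-term-≤ : ∀ {n} (f : Fin n → ℕ) i → f i ≤ ∑[ j < n ] f j
∑-term-≤ {suc n} f i = ≤-trans (m≤m+n (f i) _) (≤-reflexive (sym (sum-remove {i = i} f)))

𝟙-true : ∀ {b} → T b → 𝟙 b ≡ 1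
𝟙-true {true} _ = refl

𝟙-false : ∀ {b} → ¬ T b → 𝟙 b ≡ 0
𝟙-false {true}  ¬b = ⊥-elim (¬b tt)
𝟙-false {false} _  = refl

𝟙-mono : ∀ {a b} → (T a → T b) → 𝟙 a ≤ 𝟙 b
𝟙-mono {false}         _   = z≤n
𝟙-mono {true}  {true}  _   = ≤-refl
𝟙-mono {true}  {false} a⇒b = ⊥-elim (a⇒b tt)

if-T : ∀ {b} {A : Set} {x y : A} → T b → (if b then x else y) ≡ x
if-T {true} _ = refl

𝟙≤1 : ∀ b → 𝟙 b ≤ 1
𝟙≤1 true  = ≤-refl
𝟙≤1 false = z≤n

if-≤-𝟙∧ : ∀ b {m c} → (T b → m ≤ 𝟙 c) → (if b then m else 0) ≤ 𝟙 (b ∧ c)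
if-≤-𝟙∧ true  m≤𝟙c = m≤𝟙c tt
if-≤-𝟙∧ false _    = z≤n

∧-intro : ∀ {x y} → T x → T y → T (x ∧ y)
∧-intro {true} _ y = y

T-∧³ : ∀ {x y z} → T (x ∧ y ∧ z) → T x × T y × T z
T-∧³ p with to T-∧ p
... | px , pyz = px , to T-∧ pyz

#-mono : ∀ {n} {f g : Fin n → Bool} → (∀ x → T (f x) → T (g x)) → # f ≤ # g
#-mono f⇒g = ∑-mono-≤ (λ x → 𝟙-mono (f⇒g x))

#-empty : ∀ {n} {c : Fin n → Bool} → (∀ x → ¬ T (c x)) → # c ≡ 0
#-empty {n} ¬c = trans (sum-cong-≗ (λ x → 𝟙-false (¬c x))) (sum-replicate-zero n)

#-split : ∀ {n} (c : Fin n → Bool) a → # c ≡ 𝟙 (c a) + # (c ─ a)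
#-split {suc n} c a = begin
  # c                                           ≡⟨ sum-remove {i = a} (𝟙 ∘ c) ⟩
  𝟙 (c a) + ∑[ j < n ] 𝟙 (c (punchIn a j))      ≡⟨ cong (_+_ (𝟙 (c a))) (sum-cong-≗ off-a) ⟨
  𝟙 (c a) + ∑[ j < n ] 𝟙 ((c ─ a) (punchIn a j))
                                                ≡⟨ cong (λ z → 𝟙 (c a) + (z + ∑[ j < n ] 𝟙 ((c ─ a) (punchIn a j)))) at-a ⟨
  𝟙 (c a) + (𝟙 ((c ─ a) a) + ∑[ j < n ] 𝟙 ((c ─ a) (punchIn a j)))
                                                ≡⟨ cong (_+_ (𝟙 (c a))) (sum-remove {i = a} (𝟙 ∘ (c ─ a))) ⟨
  𝟙 (c a) + # (c ─ a)                           ∎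
  where
  open ≡-Reasoning
  at-a : 𝟙 ((c ─ a) a) ≡ 0
  at-a with a ≟ a
  ... | yes _   = cong 𝟙 (∧-zeroʳ (c a))
  ... | no a≢a = ⊥-elim (a≢a refl)
  off-a : ∀ j → 𝟙 ((c ─ a) (punchIn a j)) ≡ 𝟙 (c (punchIn a j))
  off-a j with punchIn a j ≟ a
  ... | yes j↑≡a = ⊥-elim (punchInᵢ≢i a j j↑≡a)
  ... | no _     = cong 𝟙 (∧-identityʳ (c (punchIn a j)))

#-split∈ : ∀ {n} {c : Fin n → Bool} {a} → T (c a) → # c ≡ suc (# (c ─ a))
#-split∈ {c = c} {a} ca = trans (#-split c a) (cong (_+ # (c ─ a)) (𝟙-true ca))

T-─ : ∀ {n} {c : Fin n → Bool} {a x} → T (c x) → x ≢ a → T ((c ─ a) x)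
T-─ cx x≢a = from T-∧ (cx , fromWitnessFalse x≢a)

#-cong : ∀ {n} {f g : Fin n → Bool} → (∀ x → f x ≡ g x) → # f ≡ # g
#-cong f≗g = sum-cong-≗ (cong 𝟙 ∘ f≗g)

anyFin⁺ : ∀ {n} (f : Fin n → Bool) x → T (f x) → T (anyFin f)
anyFin⁺ f x fx = any⁺ f (lose (∈-allFin x) fx)

anyFin⁻ : ∀ {n} (f : Fin n → Bool) → T (anyFin f) → ∃ λ x → T (f x)
anyFin⁻ {n} f any-f = satisfied (any⁻ f (allFin n) any-f)

¬anyFin⇒#≡0 : ∀ {n} (f : Fin n → Bool) → ¬ T (anyFin f) → # f ≡ 0
¬anyFin⇒#≡0 f ¬any = #-empty (λ x fx → ¬any (anyFin⁺ f x fx))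

#≢0⇒anyFin : ∀ {n} (f : Fin n → Bool) → # f ≢ 0 → T (anyFin f)
#≢0⇒anyFin f #f≢0 = decidable-stable (T? (anyFin f)) (#f≢0 ∘ ¬anyFin⇒#≡0 f)

#≤𝟙-anyFin : ∀ {n} (f : Fin n → Bool) → (∀ x y → T (f x) → T (f y) → x ≡ y) → # f ≤ 𝟙 (anyFin f)
#≤𝟙-anyFin f unique with T? (anyFin f)
... | no ¬any = ≤-reflexive (trans (¬anyFin⇒#≡0 f ¬any) (sym (𝟙-false ¬any)))
... | yes any-f with anyFin⁻ f any-f
...   | x , fx = ≤-reflexive (begin
  # f               ≡⟨ #-split∈ {c = f} fx ⟩
  suc (# (f ─ x))   ≡⟨ cong suc (#-empty {c = f ─ x} only-x) ⟩
  1                 ≡⟨ 𝟙-true any-f ⟨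
  𝟙 (anyFin f)      ∎)
  where
  open ≡-Reasoning
  only-x : ∀ y → ¬ T ((f ─ x) y)
  only-x y fy─x with to T-∧ fy─x
  ... | fy , y≢x = toWitnessFalse y≢x (unique y x fy fx)

#-guard : ∀ {n} c (f : Fin n → Bool) → # (λ x → c ∧ f x) ≡ 𝟙 c * # f
#-guard {n} true  f = sym (+-identityʳ (# f))
#-guard {n} false f = sum-replicate-zero n

#-guard-≤ : ∀ {n} c (f : Fin n → Bool) → (T c → # f ≤ 1) → # (λ x → c ∧ f x) ≤ 𝟙 c
#-guard-≤ {n} true  f #f≤1 = #f≤1 tt
#-guard-≤ {n} false f _    = ≤-reflexive (sum-replicate-zero n)

#-× : ∀ {n} (a b : Fin n → Bool) → ∑[ i < n ] ∑[ j < n ] 𝟙 (a i ∧ b j) ≡ # a * # b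
#-× a b = trans (sum-cong-≗ (λ i → #-guard (a i) b)) (sym (*-distribʳ-sum (# b) (𝟙 ∘ a)))

#-xor : ∀ {n} (b p q : Fin n → Bool) →
  # (λ x → b x ∧ (p x xor q x)) + 2 * # (λ x → b x ∧ (p x ∧ q x))
    ≡ # (λ x → b x ∧ p x) + # (λ x → b x ∧ q x)
#-xor {n} b p q = begin
  # (λ x → b x ∧ (p x xor q x)) + 2 * # (λ x → b x ∧ (p x ∧ q x))
    ≡⟨ cong (_+_ (# (λ x → b x ∧ (p x xor q x)))) (*-distribˡ-sum 2 (λ x → 𝟙 (b x ∧ (p x ∧ q x)))) ⟩
  # (λ x → b x ∧ (p x xor q x)) + ∑[ x < n ] (2 * 𝟙 (b x ∧ (p x ∧ q x)))
    ≡⟨ ∑-distrib-+ (λ x → 𝟙 (b x ∧ (p x xor q x))) (λ x → 2 * 𝟙 (b x ∧ (p x ∧ q x))) ⟨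
  ∑[ x < n ] (𝟙 (b x ∧ (p x xor q x)) + 2 * 𝟙 (b x ∧ (p x ∧ q x)))
    ≡⟨ sum-cong-≗ (λ x → pointwise (b x) (p x) (q x)) ⟩
  ∑[ x < n ] (𝟙 (b x ∧ p x) + 𝟙 (b x ∧ q x))
    ≡⟨ ∑-distrib-+ (λ x → 𝟙 (b x ∧ p x)) (λ x → 𝟙 (b x ∧ q x)) ⟩
  # (λ x → b x ∧ p x) + # (λ x → b x ∧ q x) ∎
  where
  open ≡-Reasoning
  pointwise : ∀ b p q → 𝟙 (b ∧ (p xor q)) + 2 * 𝟙 (b ∧ (p ∧ q)) ≡ 𝟙 (b ∧ p) + 𝟙 (b ∧ q)
  pointwise false _     _     = refl
  pointwise true  false false = refl
  pointwise true  false true  = refl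
  pointwise true  true  false = refl
  pointwise true  true  true  = refl

∑≤#-except : ∀ {n} (g : Fin n → ℕ) (b : Fin n → Bool) e →
  (∀ w → w ≢ e → g w ≤ 𝟙 (b w)) → ∑[ w < n ] g w + 𝟙 (b e) ≤ # b + g e
∑≤#-except {suc n} g b e g≤𝟙b = begin
  ∑[ w < suc n ] g w + 𝟙 (b e)
    ≡⟨ cong (_+ 𝟙 (b e)) (sum-remove {i = e} g) ⟩
  g e + ∑[ j < n ] g (punchIn e j) + 𝟙 (b e)
    ≤⟨ +-monoˡ-≤ (𝟙 (b e)) (+-monoʳ-≤ (g e) (∑-mono-≤ (λ j → g≤𝟙b _ (punchInᵢ≢i e j)))) ⟩
  g e + ∑[ j < n ] 𝟙 (b (punchIn e j)) + 𝟙 (b e)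
    ≡⟨ swap-outer (g e) _ (𝟙 (b e)) ⟩
  𝟙 (b e) + ∑[ j < n ] 𝟙 (b (punchIn e j)) + g e
    ≡⟨ cong (_+ g e) (sum-remove {i = e} (𝟙 ∘ b)) ⟨
  # b + g e ∎
  where
  open ≤-Reasoning
  swap-outer : ∀ x y z → x + y + z ≡ z + y + x
  swap-outer = solve-∀

#-union-bound₂ : ∀ {n} (f : Fin n → Bool) (g : Fin n → Fin n → Fin n → Bool) →
  (∀ x → T (f x) → ∃₂ λ i j → T (g i j x)) → # f ≤ ∑[ i < n ] ∑[ j < n ] # (g i j)
#-union-bound₂ {n} f g cover = begin
  # f                                          ≤⟨ ∑-mono-≤ covered ⟩
  ∑[ x < n ] ∑[ i < n ] ∑[ j < n ] 𝟙 (g i j x) ≡⟨ ∑-comm (λ x i → ∑[ j < n ] 𝟙 (g i j x)) ⟩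
  ∑[ i < n ] ∑[ x < n ] ∑[ j < n ] 𝟙 (g i j x) ≡⟨ sum-cong-≗ (λ i → ∑-comm (λ x j → 𝟙 (g i j x))) ⟩
  ∑[ i < n ] ∑[ j < n ] # (g i j)              ∎
  where
  open ≤-Reasoning
  covered : ∀ x → 𝟙 (f x) ≤ ∑[ i < n ] ∑[ j < n ] 𝟙 (g i j x)
  covered x with T? (f x)
  ... | no ¬fx = ≤-trans (≤-reflexive (𝟙-false ¬fx)) z≤n
  ... | yes fx with cover x fx
  ...   | i , j , gijx = begin
    𝟙 (f x)                             ≡⟨ trans (𝟙-true fx) (sym (𝟙-true gijx)) ⟩
    𝟙 (g i j x)                         ≤⟨ ∑-term-≤ (λ j → 𝟙 (g i j x)) j ⟩
    ∑[ j < n ] 𝟙 (g i j x)              ≤⟨ ∑-term-≤ (λ i → ∑[ j < n ] 𝟙 (g i j x)) i ⟩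
    ∑[ i < n ] ∑[ j < n ] 𝟙 (g i j x)   ∎

-- Sums over a subset

∑∈-cong : ∀ {n} (c : Fin n → Bool) {f g : Fin n → ℕ} →
  (∀ x → T (c x) → f x ≡ g x) → ∑[ x ∈ c ] f x ≡ ∑[ x ∈ c ] g x
∑∈-cong c f≡g = sum-cong-≗ (λ x → if-cong (c x) (f≡g x))
  where
  if-cong : ∀ b {m k} → (T b → m ≡ k) → (if b then m else 0) ≡ (if b then k else 0)
  if-cong true  m≡k = m≡k tt
  if-cong false _   = refl

∑∈-mono-≤ : ∀ {n} (c : Fin n → Bool) {f g : Fin n → ℕ} →
  (∀ x → T (c x) → f x ≤ g x) → ∑[ x ∈ c ] f x ≤ ∑[ x ∈ c ] g x
∑∈-mono-≤ c f≤g = ∑-mono-≤ (λ x → if-mono (c x) (f≤g x))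
  where
  if-mono : ∀ b {m k} → (T b → m ≤ k) → (if b then m else 0) ≤ (if b then k else 0)
  if-mono true  m≤k = m≤k tt
  if-mono false _   = z≤n

∑∈-distrib-+ : ∀ {n} (c : Fin n → Bool) (f g : Fin n → ℕ) →
  ∑[ x ∈ c ] (f x + g x) ≡ ∑[ x ∈ c ] f x + ∑[ x ∈ c ] g x
∑∈-distrib-+ c f g = trans (sum-cong-≗ (λ x → if-+ (c x)))
                           (∑-distrib-+ (λ x → if c x then f x else 0) (λ x → if c x then g x else 0))
  where
  if-+ : ∀ b {m k} → (if b then m + k else 0) ≡ (if b then m else 0) + (if b then k else 0)
  if-+ true  = refl
  if-+ false = refl

∑∈-*-distribˡ : ∀ {n} (c : Fin n → Bool) k (f : Fin n → ℕ) → ∑[ x ∈ c ] (k * f x) ≡ k * ∑[ x ∈ c ] f x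
∑∈-*-distribˡ c k f = trans (sum-cong-≗ (λ x → if-* (c x))) (sym (*-distribˡ-sum k (λ x → if c x then f x else 0)))
  where
  if-* : ∀ b {m} → (if b then k * m else 0) ≡ k * (if b then m else 0)
  if-* true  = refl
  if-* false = sym (*-zeroʳ k)

∑∈-const : ∀ {n} (c : Fin n → Bool) k → ∑[ x ∈ c ] k ≡ k * # c
∑∈-const c k = trans (sum-cong-≗ (λ x → if-k (c x))) (sym (*-distribˡ-sum k (𝟙 ∘ c)))
  where
  if-k : ∀ b → (if b then k else 0) ≡ k * 𝟙 b
  if-k true  = sym (*-identityʳ k)
  if-k false = sym (*-zeroʳ k)

∑∈-swap : ∀ {n} (a b : Fin n → Bool) (r : Fin n → Fin n → Bool) (f : Fin n → ℕ) →
  ∑[ x ∈ a ] ∑[ y ∈ (λ y → b y ∧ r x y) ] f y ≡ ∑[ y ∈ b ] (f y * # (λ x → a x ∧ r x y))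
∑∈-swap {n} a b r f = begin
  ∑[ x < n ] (if a x then ∑[ y < n ] (if b y ∧ r x y then f y else 0) else 0)
    ≡⟨ sum-cong-≗ (λ x → if-∑ (a x) (λ y → if b y ∧ r x y then f y else 0)) ⟩
  ∑[ x < n ] ∑[ y < n ] (if a x then (if b y ∧ r x y then f y else 0) else 0)
    ≡⟨ sum-cong-≗ (λ x → sum-cong-≗ (λ y → guard-swap (a x) (b y) (r x y))) ⟩
  ∑[ x < n ] ∑[ y < n ] (if b y then (if a x ∧ r x y then f y else 0) else 0)
    ≡⟨ ∑-comm (λ x y → if b y then (if a x ∧ r x y then f y else 0) else 0) ⟩
  ∑[ y < n ] ∑[ x < n ] (if b y then (if a x ∧ r x y then f y else 0) else 0)
    ≡⟨ sum-cong-≗ (λ y → if-∑ (b y) (λ x → if a x ∧ r x y then f y else 0)) ⟨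
  ∑[ y ∈ b ] ∑[ x ∈ (λ x → a x ∧ r x y) ] f y
    ≡⟨ ∑∈-cong b (λ y _ → ∑∈-const (λ x → a x ∧ r x y) (f y)) ⟩
  ∑[ y ∈ b ] (f y * # (λ x → a x ∧ r x y)) ∎
  where
  open ≡-Reasoning
  if-∑ : ∀ c (g : Fin n → ℕ) → (if c then ∑[ y < n ] g y else 0) ≡ ∑[ y < n ] (if c then g y else 0)
  if-∑ true  g = refl
  if-∑ false g = sym (sum-replicate-zero n)
  guard-swap : ∀ a b r {v} →
    (if a then (if b ∧ r then v else 0) else 0) ≡ (if b then (if a ∧ r then v else 0) else 0)
  guard-swap true  true  r = refl
  guard-swap true  false r = refl
  guard-swap false true  r = refl
  guard-swap false false r = refl

∑∈-swap-# : ∀ {n} (a b : Fin n → Bool) (r : Fin n → Fin n → Bool) →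
  ∑[ x ∈ a ] # (λ y → b y ∧ r x y) ≡ ∑[ y ∈ b ] # (λ x → a x ∧ r x y)
∑∈-swap-# a b r = trans (∑∈-swap a b r (λ _ → 1)) (∑∈-cong b (λ y _ → *-identityˡ _))

∑∈-pairs : ∀ {n} (a c : Fin n → Bool) (r : Fin n → Fin n → Bool) →
  ∑[ e ∈ a ] ∑[ w ∈ a ] # (λ x → c x ∧ r x e ∧ r x w)
    ≡ ∑[ x ∈ c ] (# (λ e → a e ∧ r x e) * # (λ e → a e ∧ r x e))
∑∈-pairs a c r = begin
  ∑[ e ∈ a ] ∑[ w ∈ a ] # (λ x → c x ∧ r x e ∧ r x w)
    ≡⟨ ∑∈-cong a (λ e _ → ∑∈-cong a (λ w _ → #-cong (λ x → ∧-assoc (c x) (r x e) (r x w)))) ⟨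
  ∑[ e ∈ a ] ∑[ w ∈ a ] # (λ x → (c x ∧ r x e) ∧ r x w)
    ≡⟨ ∑∈-cong a (λ e _ → ∑∈-swap-# a (λ x → c x ∧ r x e) (λ w x → r x w)) ⟩
  ∑[ e ∈ a ] ∑[ x ∈ (λ x → c x ∧ r x e) ] # (λ w → a w ∧ r x w)
    ≡⟨ ∑∈-swap a c (λ e x → r x e) (λ x → # (λ w → a w ∧ r x w)) ⟩
  ∑[ x ∈ c ] (# (λ e → a e ∧ r x e) * # (λ e → a e ∧ r x e)) ∎
  where open ≡-Reasoning

-- (d − 4)² ≥ 0
8*d≤d*d+16 : ∀ d → 8 * d ≤ d * d + 16
8*d≤d*d+16 0 = z≤n
8*d≤d*d+16 1 = m≤m+n 8 9
8*d≤d*d+16 2 = m≤m+n 16 4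
8*d≤d*d+16 3 = m≤m+n 24 1
8*d≤d*d+16 d@(suc (suc (suc (suc k)))) = ≤-trans (m≤m+n (8 * d) (k * k)) (≤-reflexive (sym (expand k)))
  where
  expand : ∀ k → (4 + k) * (4 + k) + 16 ≡ 8 * (4 + k) + k * k
  expand = solve-∀

∑∈-square-bound : ∀ {n} (c : Fin n → Bool) (d : Fin n → ℕ) →
  8 * ∑[ x ∈ c ] d x ≤ ∑[ x ∈ c ] (d x * d x) + 16 * # c
∑∈-square-bound c d = begin
  8 * ∑[ x ∈ c ] d x                          ≡⟨ ∑∈-*-distribˡ c 8 d ⟨
  ∑[ x ∈ c ] (8 * d x)                        ≤⟨ ∑∈-mono-≤ c (λ x _ → 8*d≤d*d+16 (d x)) ⟩
  ∑[ x ∈ c ] (d x * d x + 16)                 ≡⟨ ∑∈-distrib-+ c (λ x → d x * d x) (λ _ → 16) ⟩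
  ∑[ x ∈ c ] (d x * d x) + ∑[ x ∈ c ] 16      ≡⟨ cong (_+_ (∑[ x ∈ c ] (d x * d x))) (∑∈-const c 16) ⟩
  ∑[ x ∈ c ] (d x * d x) + 16 * # c           ∎
  where open ≤-Reasoning

sumℤ-difference : ∀ {n} (c : Fin n → Bool) (f g : Fin n → ℕ) →
  sumℤ c (λ x → + f x -ℤ + g x) ≡ + ∑[ x ∈ c ] f x -ℤ + ∑[ x ∈ c ] g x
sumℤ-difference {n} c f g = over-tabulate n id
  where
  step : Fin n → ℤ → ℤ
  step x acc = if c x then (+ f x -ℤ + g x) +ℤ acc else acc
  regroup : ∀ a b s t → (+ a -ℤ + b) +ℤ (+ s -ℤ + t) ≡ + (a + s) -ℤ + (b + t)
  regroup a b s t rewrite ℤ.pos-+ a s | ℤ.pos-+ b t = lemma (+ a) (+ b) (+ s) (+ t)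
    where
    lemma : ∀ x y z w → (x -ℤ y) +ℤ (z -ℤ w) ≡ (x +ℤ z) -ℤ (y +ℤ w)
    lemma = ℤ-Solver.solve-∀
  over-tabulate : ∀ m (h : Fin m → Fin n) → foldr step (+ 0) (tabulate h)
    ≡ + ∑[ i < m ] (if c (h i) then f (h i) else 0) -ℤ + ∑[ i < m ] (if c (h i) then g (h i) else 0)
  over-tabulate zero    h = refl
  over-tabulate (suc m) h with c (h zero)
  ... | true  = trans (cong ((+ f (h zero) -ℤ + g (h zero)) +ℤ_) (over-tabulate m (h ∘ suc)))
                      (regroup (f (h zero)) (g (h zero)) _ _)
  ... | false = over-tabulate m (h ∘ suc)

0<m-n⇒n<m : ∀ m n → + 0 <ℤ + m -ℤ + n → n < m
0<m-n⇒n<m m n 0<m-n = ≰⇒> (λ m≤n → ℤ.<⇒≱ 0<m-n (ℤ.i≤j⇒i-j≤0 (ℤ.+≤+ m≤n)))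

0<a-b+c : ∀ a b c → b < a + c → + 0 <ℤ (+ a -ℤ + b) +ℤ + c
0<a-b+c a b c b<a+c = subst₂ _<ℤ_ (ℤ.+-inverseʳ (+ b)) regroup (ℤ.+-monoˡ-< (- + b) (+<+ b<a+c))
  where
  regroup : + (a + c) -ℤ + b ≡ (+ a -ℤ + b) +ℤ + c
  regroup rewrite ℤ.pos-+ a c = lemma (+ a) (+ b) (+ c)
    where
    lemma : ∀ x y z → (x +ℤ z) -ℤ y ≡ (x -ℤ y) +ℤ z
    lemma = ℤ-Solver.solve-∀

-- Almost polyhedral posets of rank two

module AlmostPolyhedralCounting (P : FinPoset) (ρ : Fin' P → ℕ) (ap : AlmostPolyhedral P ρ) where
  open FinPoset P using (n; le; isPO)
  open AlmostPolyhedral ap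
  open IsPartialOrder isPO using () renaming (refl to le-refl; trans to le-trans)

  infix 7 _≺_
  _≺_ : Fin n → Fin n → Bool
  a ≺ b = cov P a b

  vertex edge face : Fin n → Bool
  vertex = inRank P ρ 0
  edge   = inRank P ρ 1
  face   = inRank P ρ 2

  rank-of : ∀ {i x} → T (inRank P ρ i x) → ρ x ≡ i
  rank-of {i} {x} = ≡ᵇ⇒≡ (ρ x) i

  ≢-by-rank : ∀ {i j x y} → T (inRank P ρ i x) → T (inRank P ρ j y) → i ≢ j → x ≢ y
  ≢-by-rank x∈Pᵢ y∈Pⱼ i≢j refl = i≢j (trans (sym (rank-of x∈Pᵢ)) (rank-of y∈Pⱼ))

  ≺⇒< : ∀ {a b} → T (a ≺ b) → T (lt P a b)
  ≺⇒< {a} {b} = proj₁ ∘ to (T-∧ {lt P a b} {not (anyFin (λ c → lt P a c ∧ lt P c b))})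

  ≺⇒≤ : ∀ {a b} → T (a ≺ b) → T (le a b)
  ≺⇒≤ {a} {b} = proj₁ ∘ to (T-∧ {le a b} {not ⌊ a ≟ b ⌋}) ∘ ≺⇒<

  ≺⇒≢ : ∀ {a b} → T (a ≺ b) → a ≢ b
  ≺⇒≢ {a} {b} = toWitnessFalse ∘ proj₂ ∘ to (T-∧ {le a b} {not ⌊ a ≟ b ⌋}) ∘ ≺⇒<

  -- [u, σ] has four elements, three of which are u, e and σ.
  strictly-between-≤1 : ∀ {u e σ} → T (vertex u) → T (face σ) → T (u ≺ e) → T (e ≺ σ) →
    # ((λ w → u ≺ w ∧ w ≺ σ) ─ e) ≤ 1
  strictly-between-≤1 {u} {e} {σ} u-vertex σ-face u≺e e≺σ = +-cancelˡ-≤ 3 _ _ (begin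
    3 + # ((λ w → u ≺ w ∧ w ≺ σ) ─ e) ≤⟨ +-monoʳ-≤ 3 (#-mono inside) ⟩
    3 + # (((I ─ u) ─ σ) ─ e)          ≡⟨ remove-u-σ-e ⟨
    # I                                ≡⟨ count≡# I ⟨
    count I                            ≡⟨ cond4 u σ (rank-of u-vertex) (rank-of σ-face) u<σ ⟩
    4                                  ∎)
    where
    open ≤-Reasoning
    I : Fin n → Bool
    I x = le u x ∧ le x σ
    u≤σ : T (le u σ)
    u≤σ = le-trans (≺⇒≤ u≺e) (≺⇒≤ e≺σ)
    σ≢u : σ ≢ u
    σ≢u = ≢-by-rank σ-face u-vertex (λ ())
    u<σ : T (lt P u σ)
    u<σ = from T-∧ (u≤σ , fromWitnessFalse (σ≢u ∘ sym))
    remove-u-σ-e : # I ≡ 3 + # (((I ─ u) ─ σ) ─ e)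
    remove-u-σ-e = trans (#-split∈ {c = I} (∧-intro le-refl u≤σ))
      (cong suc (trans (#-split∈ {c = I ─ u} (T-─ {c = I} (∧-intro u≤σ le-refl) σ≢u))
      (cong suc (#-split∈ {c = (I ─ u) ─ σ}
        (T-─ {c = I ─ u} (T-─ {c = I} (∧-intro (≺⇒≤ u≺e) (≺⇒≤ e≺σ)) (≺⇒≢ u≺e ∘ sym)) (≺⇒≢ e≺σ))))))
    inside : ∀ w → T (((λ w → u ≺ w ∧ w ≺ σ) ─ e) w) → T ((((I ─ u) ─ σ) ─ e) w)
    inside w p with to T-∧ p
    ... | u≺w∧w≺σ , w≉e with to T-∧ u≺w∧w≺σ
    ...   | u≺w , w≺σ =
      ∧-intro (T-─ {c = I ─ u} (T-─ {c = I} (∧-intro (≺⇒≤ u≺w) (≺⇒≤ w≺σ)) (≺⇒≢ u≺w ∘ sym)) (≺⇒≢ w≺σ)) w≉e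

  commonVertex commonFace : Fin n → Fin n → Fin n → Bool
  commonVertex e w u = vertex u ∧ u ≺ e ∧ u ≺ w
  commonFace   e w σ = face σ ∧ e ≺ σ ∧ w ≺ σ

  sharesVertex sharesFace : Fin n → Fin n → Bool
  sharesVertex e w = anyFin (commonVertex e w)
  sharesFace   e w = anyFin (commonFace e w)

  #commonVertex-self : ∀ {e} → T (edge e) → # (commonVertex e e) ≡ 2
  #commonVertex-self {e} e-edge = begin
    # (commonVertex e e)         ≡⟨ #-cong (λ u → cong (vertex u ∧_) (∧-idem (u ≺ e))) ⟩
    # (λ u → vertex u ∧ u ≺ e)   ≡⟨ count≡# (λ u → vertex u ∧ u ≺ e) ⟨
    B₁ P ρ e                     ≡⟨ cond1 e (rank-of e-edge) ⟩
    2                            ∎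
    where open ≡-Reasoning

  #commonFace-self : ∀ e → # (commonFace e e) ≡ A₁ P ρ e
  #commonFace-self e = trans (#-cong (λ σ → cong (face σ ∧_) (∧-idem (e ≺ σ))))
                             (sym (count≡# (λ σ → face σ ∧ e ≺ σ)))

  #commonVertex-≤ : ∀ {e w} → T (edge e) → T (edge w) → w ≢ e → # (commonVertex e w) ≤ 𝟙 (sharesVertex e w)
  #commonVertex-≤ {e} {w} e-edge w-edge w≢e = #≤𝟙-anyFin (commonVertex e w) unique
    where
    unique : ∀ u v → T (commonVertex e w u) → T (commonVertex e w v) → u ≡ v
    unique u v cu cv with T-∧³ cu | T-∧³ cv
    ... | u-vertex , u≺e , u≺w | v-vertex , v≺e , v≺w =
      cond2 e w (rank-of e-edge) (rank-of w-edge) (w≢e ∘ sym) u v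
        (rank-of u-vertex) (rank-of v-vertex) u≺e u≺w v≺e v≺w

  #commonFace-≤ : ∀ {e w} → T (edge e) → T (edge w) → w ≢ e → # (commonFace e w) ≤ 𝟙 (sharesFace e w)
  #commonFace-≤ {e} {w} e-edge w-edge w≢e = #≤𝟙-anyFin (commonFace e w) unique
    where
    unique : ∀ σ τ → T (commonFace e w σ) → T (commonFace e w τ) → σ ≡ τ
    unique σ τ cσ cτ with T-∧³ cσ | T-∧³ cτ
    ... | σ-face , e≺σ , w≺σ | τ-face , e≺τ , w≺τ =
      cond3 e w (rank-of e-edge) (rank-of w-edge) (w≢e ∘ sym) σ τ
        (rank-of σ-face) (rank-of τ-face) e≺σ w≺σ e≺τ w≺τ

  sharesBoth : Fin n → Fin n → Bool
  sharesBoth e w = edge w ∧ (sharesFace e w ∧ sharesVertex e w)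

  N₁-identity : ∀ e →
    N₁ P ρ e + 2 * # (sharesBoth e) ≡ # (λ w → edge w ∧ sharesFace e w) + # (λ w → edge w ∧ sharesVertex e w)
  N₁-identity e = trans (cong (_+ 2 * # (sharesBoth e))
                                 (count≡# (λ w → edge w ∧ (sharesFace e w xor sharesVertex e w))))
                           (#-xor edge (sharesFace e) (sharesVertex e))

  module _ {e} (e-edge : T (edge e)) where

    sharesVertex-self : T (sharesVertex e e)
    sharesVertex-self = #≢0⇒anyFin (commonVertex e e) (λ #≡0 → 2≢0 (trans (sym (#commonVertex-self e-edge)) #≡0))
      where
      2≢0 : 2 ≢ 0
      2≢0 ()

    ∑commonVertex-bound : ∑[ w ∈ edge ] # (commonVertex e w) + 1 ≤ # (λ w → edge w ∧ sharesVertex e w) + 2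
    ∑commonVertex-bound = subst₂ (λ i k → ∑[ w ∈ edge ] # (commonVertex e w) + i ≤ # (λ w → edge w ∧ sharesVertex e w) + k)
      (𝟙-true (∧-intro e-edge sharesVertex-self))
      (trans (if-T e-edge) (#commonVertex-self e-edge))
      (∑≤#-except _ (λ w → edge w ∧ sharesVertex e w) e
        (λ w w≢e → if-≤-𝟙∧ (edge w) (λ w-edge → #commonVertex-≤ e-edge w-edge w≢e)))

    ∑commonFace-bound : ∑[ w ∈ edge ] # (commonFace e w) + 𝟙 (edge e ∧ sharesFace e e)
                    ≤ # (λ w → edge w ∧ sharesFace e w) + A₁ P ρ e
    ∑commonFace-bound = subst (λ k → ∑[ w ∈ edge ] # (commonFace e w) + 𝟙 (edge e ∧ sharesFace e e)
                                 ≤ # (λ w → edge w ∧ sharesFace e w) + k)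
      (trans (if-T e-edge) (#commonFace-self e))
      (∑≤#-except _ (λ w → edge w ∧ sharesFace e w) e
        (λ w w≢e → if-≤-𝟙∧ (edge w) (λ w-edge → #commonFace-≤ e-edge w-edge w≢e)))

    #sharesBoth─e-bound : # (sharesBoth e ─ e) ≤ 2 * A₁ P ρ e
    #sharesBoth─e-bound = begin
      # (sharesBoth e ─ e)                         ≤⟨ #-union-bound₂ (sharesBoth e ─ e) through cover ⟩
      ∑[ σ < n ] ∑[ u < n ] # (through σ u)        ≤⟨ ∑-mono-≤ (λ σ → ∑-mono-≤ (through-≤ σ)) ⟩
      ∑[ σ < n ] ∑[ u < n ] 𝟙 (above σ ∧ below u)  ≡⟨ #-× above below ⟩
      # above * # below                            ≡⟨ cong₂ _*_ (count≡# above) (count≡# below) ⟨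
      A₁ P ρ e * B₁ P ρ e                          ≡⟨ cong (A₁ P ρ e *_) (cond1 e (rank-of e-edge)) ⟩
      A₁ P ρ e * 2                                 ≡⟨ *-comm (A₁ P ρ e) 2 ⟩
      2 * A₁ P ρ e                                 ∎
      where
      open ≤-Reasoning
      above below : Fin n → Bool
      above σ = face σ ∧ e ≺ σ
      below u = vertex u ∧ u ≺ e
      through : Fin n → Fin n → Fin n → Bool
      through σ u w = (above σ ∧ below u) ∧ ((λ w → u ≺ w ∧ w ≺ σ) ─ e) w
      cover : ∀ w → T ((sharesBoth e ─ e) w) → ∃₂ λ σ u → T (through σ u w)
      cover w p with to (T-∧ {sharesBoth e w} {not ⌊ w ≟ e ⌋}) p
      ... | both , w≉e with T-∧³ {edge w} {sharesFace e w} {sharesVertex e w} both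
      ... | _ , sf , sv with anyFin⁻ (commonFace e w) sf | anyFin⁻ (commonVertex e w) sv
      ... | σ , cσ | u , cu with T-∧³ {face σ} {e ≺ σ} {w ≺ σ} cσ | T-∧³ {vertex u} {u ≺ e} {u ≺ w} cu
      ... | σ-face , e≺σ , w≺σ | u-vertex , u≺e , u≺w =
        σ , u , ∧-intro (∧-intro (∧-intro σ-face e≺σ) (∧-intro u-vertex u≺e)) (∧-intro (∧-intro u≺w w≺σ) w≉e)
      through-≤ : ∀ σ u → # (through σ u) ≤ 𝟙 (above σ ∧ below u)
      through-≤ σ u = #-guard-≤ (above σ ∧ below u) ((λ w → u ≺ w ∧ w ≺ σ) ─ e) λ p →
        let (σ-above , u-below) = to T-∧ p
            (σ-face , e≺σ) = to T-∧ σ-above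
            (u-vertex , u≺e) = to T-∧ u-below
        in strictly-between-≤1 u-vertex σ-face u≺e e≺σ

    #sharesBoth-bound : # (sharesBoth e) ≤ 𝟙 (edge e ∧ sharesFace e e) + 2 * A₁ P ρ e
    #sharesBoth-bound = begin
      # (sharesBoth e)                                ≡⟨ #-split (sharesBoth e) e ⟩
      𝟙 (sharesBoth e e) + # (sharesBoth e ─ e)       ≤⟨ +-mono-≤ (𝟙-mono at-e) #sharesBoth─e-bound ⟩
      𝟙 (edge e ∧ sharesFace e e) + 2 * A₁ P ρ e      ∎
      where
      open ≤-Reasoning
      at-e : T (sharesBoth e e) → T (edge e ∧ sharesFace e e)
      at-e p with T-∧³ {edge e} {sharesFace e e} {sharesVertex e e} p
      ... | e-edge′ , sf , _ = ∧-intro e-edge′ sf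

    ∑common-bound : ∑[ w ∈ edge ] # (commonVertex e w) + ∑[ w ∈ edge ] # (commonFace e w)
                   ≤ N₁ P ρ e + 5 * A₁ P ρ e + 2
    ∑common-bound = combine {A = A₁ P ρ e} {N = N₁ P ρ e}
      ∑commonVertex-bound ∑commonFace-bound #sharesBoth-bound (N₁-identity e) (𝟙≤1 (edge e ∧ sharesFace e e))
      where
      combine : ∀ {Lg Ug i L U A N X} → Lg + 1 ≤ L + 2 → Ug + i ≤ U + A → X ≤ i + 2 * A →
                N + 2 * X ≡ U + L → i ≤ 1 → Lg + Ug ≤ N + 5 * A + 2
      combine {Lg} {Ug} {i} {L} {U} {A} {N} {X} lower upper both N-id i≤1 =
        +-cancelʳ-≤ (1 + i) _ _ (begin
          Lg + Ug + (1 + i)                    ≡⟨ regroup₁ Lg Ug i ⟩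
          (Lg + 1) + (Ug + i)                  ≤⟨ +-mono-≤ lower upper ⟩
          (L + 2) + (U + A)                    ≡⟨ regroup₂ L U A ⟩
          (U + L) + (2 + A)                    ≡⟨ cong (_+ (2 + A)) N-id ⟨
          (N + 2 * X) + (2 + A)                ≤⟨ +-monoˡ-≤ (2 + A) (+-monoʳ-≤ N (*-monoʳ-≤ 2 both)) ⟩
          (N + 2 * (i + 2 * A)) + (2 + A)      ≡⟨ regroup₃ N i A ⟩
          N + 5 * A + (1 + i) + (1 + i)        ≤⟨ +-monoˡ-≤ (1 + i) (+-monoʳ-≤ (N + 5 * A) (s≤s i≤1)) ⟩
          N + 5 * A + 2 + (1 + i)              ∎)
        where
        open ≤-Reasoning
        regroup₁ : ∀ Lg Ug i → Lg + Ug + (1 + i) ≡ (Lg + 1) + (Ug + i)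
        regroup₁ = solve-∀
        regroup₂ : ∀ L U A → (L + 2) + (U + A) ≡ (U + L) + (2 + A)
        regroup₂ = solve-∀
        regroup₃ : ∀ N i A → (N + 2 * (i + 2 * A)) + (2 + A) ≡ N + 5 * A + (1 + i) + (1 + i)
        regroup₃ = solve-∀

  sumA₁≡∑A₁ : sumA₁ P ρ ≡ ∑[ e ∈ edge ] A₁ P ρ e
  sumA₁≡∑A₁ = sum-allFin n (λ e → if edge e then A₁ P ρ e else 0)

  ∑B₁ : ∑[ e ∈ edge ] B₁ P ρ e ≡ 2 * p P ρ 1
  ∑B₁ = trans (∑∈-cong edge (λ e e-edge → cond1 e (rank-of e-edge)))
              (trans (∑∈-const edge 2) (cong (2 *_) (sym (count≡# edge))))

  up-degree down-degree : Fin n → ℕ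
  up-degree   x = # (λ e → edge e ∧ x ≺ e)
  down-degree x = # (λ e → edge e ∧ e ≺ x)

  ∑up-degree : ∑[ u ∈ vertex ] up-degree u ≡ 2 * p P ρ 1
  ∑up-degree = trans (∑∈-swap-# vertex edge _≺_)
                     (trans (∑∈-cong edge (λ e _ → sym (count≡# (λ u → vertex u ∧ u ≺ e)))) ∑B₁)

  ∑down-degree : ∑[ σ ∈ face ] down-degree σ ≡ sumA₁ P ρ
  ∑down-degree = trans (∑∈-swap-# face edge (λ σ e → e ≺ σ))
                       (trans (∑∈-cong edge (λ e _ → sym (count≡# (λ σ → face σ ∧ e ≺ σ)))) (sym sumA₁≡∑A₁))

  ∑∑commonVertex : ∑[ e ∈ edge ] ∑[ w ∈ edge ] # (commonVertex e w) ≡ ∑[ u ∈ vertex ] (up-degree u * up-degree u)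
  ∑∑commonVertex = ∑∈-pairs edge vertex _≺_

  ∑∑commonFace : ∑[ e ∈ edge ] ∑[ w ∈ edge ] # (commonFace e w) ≡ ∑[ σ ∈ face ] (down-degree σ * down-degree σ)
  ∑∑commonFace = ∑∈-pairs edge face (λ σ e → e ≺ σ)

  ∑∑common-bound : ∑[ u ∈ vertex ] (up-degree u * up-degree u) + ∑[ σ ∈ face ] (down-degree σ * down-degree σ)
                  ≤ ∑[ e ∈ edge ] N₁ P ρ e + 5 * sumA₁ P ρ + 2 * p P ρ 1
  ∑∑common-bound = begin
    ∑[ u ∈ vertex ] (up-degree u * up-degree u) + ∑[ σ ∈ face ] (down-degree σ * down-degree σ)
      ≡⟨ cong₂ _+_ ∑∑commonVertex ∑∑commonFace ⟨
    ∑[ e ∈ edge ] ∑[ w ∈ edge ] # (commonVertex e w) + ∑[ e ∈ edge ] ∑[ w ∈ edge ] # (commonFace e w)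
      ≡⟨ ∑∈-distrib-+ edge _ _ ⟨
    ∑[ e ∈ edge ] (∑[ w ∈ edge ] # (commonVertex e w) + ∑[ w ∈ edge ] # (commonFace e w))
      ≤⟨ ∑∈-mono-≤ edge (λ e e-edge → ∑common-bound e-edge) ⟩
    ∑[ e ∈ edge ] (N₁ P ρ e + 5 * A₁ P ρ e + 2)
      ≡⟨ ∑∈-distrib-+ edge _ _ ⟩
    ∑[ e ∈ edge ] (N₁ P ρ e + 5 * A₁ P ρ e) + ∑[ e ∈ edge ] 2
      ≡⟨ cong₂ _+_ (∑∈-distrib-+ edge _ _) (trans (∑∈-const edge 2) (cong (2 *_) (sym (count≡# edge)))) ⟩
    ∑[ e ∈ edge ] N₁ P ρ e + ∑[ e ∈ edge ] (5 * A₁ P ρ e) + 2 * p P ρ 1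
      ≡⟨ cong (λ s → ∑[ e ∈ edge ] N₁ P ρ e + s + 2 * p P ρ 1)
              (trans (∑∈-*-distribˡ edge 5 (A₁ P ρ)) (cong (5 *_) (sym sumA₁≡∑A₁))) ⟩
    ∑[ e ∈ edge ] N₁ P ρ e + 5 * sumA₁ P ρ + 2 * p P ρ 1 ∎
    where open ≤-Reasoning

  ∑N₁-bound : 14 * p P ρ 1 + 3 * sumA₁ P ρ ≤ ∑[ e ∈ edge ] N₁ P ρ e + 16 * (p P ρ 0 + p P ρ 2)
  ∑N₁-bound = combine (p P ρ 0) (p P ρ 1) (p P ρ 2) (sumA₁ P ρ) (∑[ e ∈ edge ] N₁ P ρ e)
                (∑[ u ∈ vertex ] (up-degree u * up-degree u)) (∑[ σ ∈ face ] (down-degree σ * down-degree σ))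
                vertex-bound face-bound ∑∑common-bound
    where
    open ≤-Reasoning
    vertex-bound : 16 * p P ρ 1 ≤ ∑[ u ∈ vertex ] (up-degree u * up-degree u) + 16 * p P ρ 0
    vertex-bound = begin
      16 * p P ρ 1                     ≡⟨ *-assoc 8 2 (p P ρ 1) ⟩
      8 * (2 * p P ρ 1)                ≡⟨ cong (8 *_) ∑up-degree ⟨
      8 * ∑[ u ∈ vertex ] up-degree u  ≤⟨ ∑∈-square-bound vertex up-degree ⟩
      ∑[ u ∈ vertex ] (up-degree u * up-degree u) + 16 * # vertex
        ≡⟨ cong (λ k → ∑[ u ∈ vertex ] (up-degree u * up-degree u) + 16 * k) (count≡# vertex) ⟨
      ∑[ u ∈ vertex ] (up-degree u * up-degree u) + 16 * p P ρ 0 ∎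
    face-bound : 8 * sumA₁ P ρ ≤ ∑[ σ ∈ face ] (down-degree σ * down-degree σ) + 16 * p P ρ 2
    face-bound = begin
      8 * sumA₁ P ρ                      ≡⟨ cong (8 *_) ∑down-degree ⟨
      8 * ∑[ σ ∈ face ] down-degree σ    ≤⟨ ∑∈-square-bound face down-degree ⟩
      ∑[ σ ∈ face ] (down-degree σ * down-degree σ) + 16 * # face
        ≡⟨ cong (λ k → ∑[ σ ∈ face ] (down-degree σ * down-degree σ) + 16 * k) (count≡# face) ⟨
      ∑[ σ ∈ face ] (down-degree σ * down-degree σ) + 16 * p P ρ 2 ∎
    combine : ∀ p₀ p₁ p₂ A N D F → 16 * p₁ ≤ D + 16 * p₀ → 8 * A ≤ F + 16 * p₂ →
              D + F ≤ N + 5 * A + 2 * p₁ → 14 * p₁ + 3 * A ≤ N + 16 * (p₀ + p₂)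
    combine p₀ p₁ p₂ A N D F vertices faces edges = +-cancelʳ-≤ (2 * p₁ + 5 * A) _ _ (begin
      14 * p₁ + 3 * A + (2 * p₁ + 5 * A)      ≡⟨ regroup₁ p₁ A ⟩
      16 * p₁ + 8 * A                         ≤⟨ +-mono-≤ vertices faces ⟩
      (D + 16 * p₀) + (F + 16 * p₂)           ≡⟨ regroup₂ D F p₀ p₂ ⟩
      (D + F) + 16 * (p₀ + p₂)                ≤⟨ +-monoˡ-≤ (16 * (p₀ + p₂)) edges ⟩
      (N + 5 * A + 2 * p₁) + 16 * (p₀ + p₂)   ≡⟨ regroup₃ N A p₁ p₀ p₂ ⟩
      N + 16 * (p₀ + p₂) + (2 * p₁ + 5 * A)   ∎)
      where
      regroup₁ : ∀ p₁ A → 14 * p₁ + 3 * A + (2 * p₁ + 5 * A) ≡ 16 * p₁ + 8 * A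
      regroup₁ = solve-∀
      regroup₂ : ∀ D F p₀ p₂ → (D + 16 * p₀) + (F + 16 * p₂) ≡ (D + F) + 16 * (p₀ + p₂)
      regroup₂ = solve-∀
      regroup₃ : ∀ N A p₁ p₀ p₂ → (N + 5 * A + 2 * p₁) + 16 * (p₀ + p₂) ≡ N + 16 * (p₀ + p₂) + (2 * p₁ + 5 * A)
      regroup₃ = solve-∀

  ∑Ric≡ : sumRic P ρ ≡ + (sumA₁ P ρ + 2 * p P ρ 1) -ℤ + ∑[ e ∈ edge ] N₁ P ρ e
  ∑Ric≡ = trans (sumℤ-difference edge (λ e → A₁ P ρ e + B₁ P ρ e) (N₁ P ρ))
                (cong (λ s → + s -ℤ + ∑[ e ∈ edge ] N₁ P ρ e)
                      (trans (∑∈-distrib-+ edge (A₁ P ρ) (B₁ P ρ)) (cong₂ _+_ (sym sumA₁≡∑A₁) ∑B₁)))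

corollary3p5 : (P : FinPoset) (ρ : Fin' P → ℕ) →
    RankTwo P ρ → AlmostPolyhedral P ρ →
    0 < p P ρ 1 →
    2 * p P ρ 1 ≤ sumA₁ P ρ →
    + 0 <ℤ sumRic P ρ →
    + 0 <ℤ χgr P ρ
corollary3p5 P ρ _ ap _ 2p₁≤∑A₁ 0<∑Ric =
  0<a-b+c (p P ρ 0) (p P ρ 1) (p P ρ 2) 
    (combine (p P ρ 0) (p P ρ 1) (p P ρ 2) (sumA₁ P ρ) _ ∑N₁-bound ∑N₁<∑A₁+2p₁ 2p₁≤∑A₁)
  where
  open AlmostPolyhedralCounting P ρ ap
  ∑N₁<∑A₁+2p₁ : ∑[ e ∈ edge ] N₁ P ρ e < sumA₁ P ρ + 2 * p P ρ 1
  ∑N₁<∑A₁+2p₁ = 0<m-n⇒n<m _ _ (subst (λ r → + 0 <ℤ r) ∑Ric≡ 0<∑Ric)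
  combine : ∀ p₀ p₁ p₂ A N → 14 * p₁ + 3 * A ≤ N + 16 * (p₀ + p₂) → N < A + 2 * p₁ → 2 * p₁ ≤ A →
            p₁ < p₀ + p₂
  combine p₀ p₁ p₂ A N ricci N<A+2p₁ 2p₁≤A =
    *-cancelˡ-< 16 p₁ (p₀ + p₂) (+-cancelʳ-≤ (N + 2 * p₁ + 3 * A) _ _ (begin
      suc (16 * p₁) + (N + 2 * p₁ + 3 * A)        ≡⟨ regroup₁ p₁ N A ⟩
      (14 * p₁ + 3 * A) + suc N + 2 * (2 * p₁)    ≤⟨ +-mono-≤ (+-mono-≤ ricci N<A+2p₁) (*-monoʳ-≤ 2 2p₁≤A) ⟩
      (N + 16 * (p₀ + p₂)) + (A + 2 * p₁) + 2 * A ≡⟨ regroup₂ N p₀ p₂ A p₁ ⟩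
      16 * (p₀ + p₂) + (N + 2 * p₁ + 3 * A)       ∎))
    where
    open ≤-Reasoning
    regroup₁ : ∀ p₁ N A → suc (16 * p₁) + (N + 2 * p₁ + 3 * A) ≡ (14 * p₁ + 3 * A) + suc N + 2 * (2 * p₁)
    regroup₁ = solve-∀
    regroup₂ : ∀ N p₀ p₂ A p₁ → (N + 16 * (p₀ + p₂)) + (A + 2 * p₁) + 2 * A ≡ 16 * (p₀ + p₂) + (N + 2 * p₁ + 3 * A)
    regroup₂ = solve-∀
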